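{- The deterministic algorithm Recursive LRU (DET) for online dependency-aware caching with cache size $k$ is $k$-competitive.
   Context: Online dependency-aware caching: a universe $\mathcal U$ of items is stored in slow memory; a cache holds at most $k\ge 1$ items. A directed acyclic graph $G=(\mathcal U,E)$ is given; the dependencies of an item $x$ are all items reachable from $x$ in $G$ other than $x$, and $T(x)$ denotes $x$ together with all its dependencies. Every item has at most $k-1$ dependencies. At all times the cache must be feasible: an item may be in the cache only if all its dependencies are. Requests arrive online; if a requested item $v$ is not cached, all uncached items of $T(v)$ must be fetched (evicting items as needed while keeping the cache feasible); the cost is the number of fetches. The online algorithm and the offline optimum start from the same cache. A deterministic online algorithm ALG is $c$-competitive if there is a constant $\alpha$ with $\mathrm{ALG}(\sigma)\le c\cdot\mathrm{OPT}(\sigma)+\alpha$ for every request sequence $\sigma$. Fix a total order $\tau$ on $\mathcal U$ such that whenever $y$ is a descendant of $x$, $y<_\tau x$. Algorithm DET (Recursive LRU) keeps a timestamp for each item. On a request $v$, it first iterates over the items of $T(v)$ top-to-bottom (in decreasing $\tau$ order) and assigns each a fresh timestamp larger than all previous ones (so descendants get more recent timestamps than their ancestors); then it iterates over the uncached items of $T(v)$ bottom-to-top (in increasing $\tau$ order) and, for each, if the cache is full evicts the cached item with the least recent timestamp (as in LRU), and fetches the item; finally it serves $v$. -}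

module Defs where

open import Level using (0ℓ)
open import Data.Nat using (ℕ; zero; suc; _+_; _≤_; _<_; _⊔_; _∸_; _<ᵇ_)
open import Data.Bool using (Bool; true; false; if_then_else_)
open import Data.Fin using (Fin; _≟_)
import Data.Fin as F
open import Data.Fin.Subset using (Subset; _∈_; _─_; ∣_∣; inside)
open import Data.Fin.Subset.Properties using (_∈?_)
open import Data.List using (List; []; _∷_; filter; map; reverse; length; foldr)
open import Data.Maybe using (Maybe; just; nothing)
open import Data.Product using (_×_; _,_)
open import Data.Vec using (_[_]≔_; allFin)
import Data.Vec as V
open import Relation.Binary using (Rel)
open import Relation.Binary.PropositionalEquality using (_≡_; _≢_)
open import Relation.Binary.Construct.Closure.ReflexiveTransitive using (Star)
open import Relation.Binary.Construct.Closure.Transitive using (TransClosure)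
open import Relation.Nullary using (Dec; yes; no; ¬_)
open import Relation.Nullary.Decidable using (_×-dec_; ¬?; does)
open import Function.Bundles using (_↔_; Inverse)

-- Items are Fin n.  E is the edge relation of G;  T(x) = { y | Star E x y }.
-- y is a dependency (descendant) of x iff  Star E x y  and  y ≢ x.

Acyclic : ∀ {n} → Rel (Fin n) 0ℓ → Set
Acyclic {n} E = ∀ (x : Fin n) → ¬ TransClosure E x x

Dep : ∀ {n} → Rel (Fin n) 0ℓ → Fin n → Fin n → Set
Dep E x y = Star E x y × y ≢ x

items : ∀ n → List (Fin n)
items n = Data.Vec.toList (allFin n)
  where import Data.Vec

module Model {n : ℕ} (k : ℕ) (E : Rel (Fin n) 0ℓ)
             (R? : ∀ x y → Dec (Star E x y)) where

  deps : Fin n → List (Fin n)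
  deps x = filter (λ y → R? x y ×-dec ¬? (y ≟ x)) (items n)

  Feasible : Subset n → Set
  Feasible C = ∀ x y → x ∈ C → Star E x y → y ∈ C

  ValidCache : Subset n → Set
  ValidCache C = Feasible C × ∣ C ∣ ≤ k

  -- Going from C to C' costs |C' ∖ C| fetches (the minimum number
  -- of fetches realising the change; evict C∖C' top-down, then fetch C'∖C
  -- bottom-up keeps every intermediate cache feasible and of size ≤ k).
  data Schedule : Subset n → List (Fin n) → List (Subset n) → Set where
    done : ∀ {C} → Schedule C [] []
    step : ∀ {C C' v σ S} → ValidCache C' → v ∈ C' →
           Schedule C' σ S → Schedule C (v ∷ σ) (C' ∷ S)

  scheduleCost : Subset n → List (Subset n) → ℕ
  scheduleCost C []        = 0
  scheduleCost C (C' ∷ S)  = ∣ C' ─ C ∣ + scheduleCost C' S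

  -- Algorithm DET (Recursive LRU), for the order τ given by the bijection
  -- π : x <τ y  iff  to π x < to π y.
  record DState : Set where
    constructor dstate
    field
      cache : Subset n
      stamp : Fin n → ℕ
      clock : ℕ     -- the next fresh timestamp (larger than all used ones)
      cost  : ℕ
  open DState public

  setStamp : (Fin n → ℕ) → Fin n → ℕ → (Fin n → ℕ)
  setStamp st x t y with y ≟ x
  ... | yes _ = t
  ... | no  _ = st y

  lruOf : (Fin n → ℕ) → List (Fin n) → Maybe (Fin n)
  lruOf st []       = nothing
  lruOf st (x ∷ xs) with lruOf st xs
  ... | nothing = just x
  ... | just y  = if st y <ᵇ st x then just y else just x

  cachedItems : Subset n → List (Fin n)
  cachedItems C = filter (_∈? C) (items n)

  module DET (π : Fin n ↔ Fin n) where

    τ-increasing : List (Fin n)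
    τ-increasing = map (Inverse.from π) (items n)

    -- T(v) in increasing τ order (bottom-to-top)
    T-up : Fin n → List (Fin n)
    T-up v = filter (R? v) τ-increasing

    restamp : List (Fin n) → DState → DState
    restamp []       s = s
    restamp (x ∷ xs) (dstate C st t c) =
      restamp xs (dstate C (setStamp st x t) (suc t) c)

    evictIfFull : DState → DState
    evictIfFull (dstate C st t c) with k Data.Nat.≤? ∣ C ∣
      where import Data.Nat
    ... | no  _ = dstate C st t c
    ... | yes _ with lruOf st (cachedItems C)
    ...   | nothing = dstate C st t c
    ...   | just y  = dstate (C [ y ]≔ Data.Fin.Subset.outside) st t c

    fetchAll : List (Fin n) → DState → DState
    fetchAll []       s = s
    fetchAll (x ∷ xs) s with x ∈? cache s
    ... | yes _ = fetchAll xs s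
    ... | no  _ with evictIfFull s
    ...   | dstate C st t c = fetchAll xs (dstate (C [ x ]≔ inside) st t (suc c))

    serve : Fin n → DState → DState
    serve v s = fetchAll (T-up v) (restamp (reverse (T-up v)) s)

    run : List (Fin n) → DState → DState
    run []      s = s
    run (v ∷ σ) s = run σ (serve v s)

    initState : Subset n → (Fin n → ℕ) → DState
    initState C₀ st₀ = dstate C₀ st₀ (suc (foldr _⊔_ 0 (map st₀ (items n)))) 0

    detCost : Subset n → (Fin n → ℕ) → List (Fin n) → ℕ
    detCost C₀ st₀ σ = cost (run σ (initState C₀ st₀))

{-# OPTIONS --safe #-}
module Submission where

-- Call a phase a maximal run of requests whose closures T(v) together contain at most k items.
-- The items of the current phase are exactly those stamped at or after the phase started, so they
-- carry the most recent timestamps; as there are at most k of them, LRU never evicts one while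
-- another one is missing, and DET fetches at most k items per phase. OPT, on the other hand,
-- fetches at least once per phase: as long as it does not, its cache together with the phase items
-- fits into k slots, so the phase cannot end. Charging k in advance at the start of each phase until
-- OPT pays yields DET ≤ k · OPT + 2k.

open import Defs
open import Level using (0ℓ)
open import Data.Bool using (T; true; false)
open import Data.Empty using (⊥-elim)
open import Data.Fin using (Fin; _≟_)
import Data.Fin
open import Data.Fin.Subset using (Subset; _∈_; _∉_; _⊆_; _─_; _∪_; _∩_; ∣_∣; inside; ⊥)
open import Data.Fin.Subset.Properties
  using (_∈?_; nonempty?; ∉⊥; ⊆-refl; ⊆-min; p⊆q⇒∣p∣≤∣q∣; p⊂q⇒∣p∣<∣q∣; x∈p⇒∣p-x∣<∣p∣;
         x∈p∧x∉q⇒x∈p─q; p⊆p∪q; q⊆p∪q; x∈p∪q⁺; x∈p∪q⁻; x∈p∩q⁺; x∈p∩q⁻; ∣p∩q∣≤∣p∣)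
open import Data.List using (List; []; _∷_; length; map; foldr; reverse)
open import Data.List.Membership.Propositional using () renaming (_∈_ to _∈ₗ_)
open import Data.List.Membership.Propositional.Properties using (∈-filter⁺; ∈-filter⁻; ∈-map⁺)
open import Data.List.Relation.Unary.Any using (here; there)
open import Data.List.Relation.Unary.Any.Properties using (reverse⁺; reverse⁻)
open import Data.Maybe using (just; nothing)
open import Data.Nat using (ℕ; suc; _≤_; _<_; _*_; _+_; _∸_; _⊔_; _<ᵇ_; _≤?_; z≤n; s≤s)
open import Data.Nat.Properties hiding (_≟_)
open import Data.Product using (_×_; _,_; proj₁; proj₂; ∃)
open import Data.Sum using (_⊎_; inj₁; inj₂; [_,_]′)
import Data.Vec as V
open import Data.Vec.Membership.Propositional.Properties using (∈-allFin⁺; ∈-toList⁺)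
open import Data.Vec.Properties using (lookup∘tabulate; []=⇒lookup; lookup⇒[]=; []≔-updates; []≔-minimal)
open import Function using (_∘_; id)
open import Function.Bundles using (_↔_; _⇔_; mk⇔; Inverse; Equivalence)
open import Function.Definitions using (Injective)
open import Relation.Binary using (Rel)
open import Relation.Binary.PropositionalEquality using (_≡_; _≢_; refl; sym; trans; subst; subst₂; cong)
open import Relation.Binary.Construct.Closure.ReflexiveTransitive using (Star)
open import Relation.Nullary using (Dec; yes; no; does; proof; Reflects; invert; contradiction)
open import Relation.Nullary.Decidable using (dec-true)

open Equivalence using (to; from)

∪-least : ∀ {n} {p q r : Subset n} → p ⊆ r → q ⊆ r → p ∪ q ⊆ r
∪-least {p = p} {q} p⊆r q⊆r x∈p∪q = [ p⊆r , q⊆r ]′ (x∈p∪q⁻ p q x∈p∪q)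

∪-monoʳ-⊆ : ∀ {n} {p q r : Subset n} → q ⊆ r → p ∪ q ⊆ p ∪ r
∪-monoʳ-⊆ {p = p} {r = r} q⊆r = ∪-least (p⊆p∪q r) (q⊆p∪q p r ∘ q⊆r)

∈-insert : ∀ {n} (p : Subset n) x {y} → y ∈ p → y ∈ p V.[ x ]≔ inside
∈-insert p x {y} y∈p with y ≟ x
... | yes refl = []≔-updates p x
... | no y≢x   = []≔-minimal p y x y≢x y∈p

⊆⊎∣─∣≥1 : ∀ {n} (p q : Subset n) → p ⊆ q ⊎ 1 ≤ ∣ p ─ q ∣
⊆⊎∣─∣≥1 p q with nonempty? (p ─ q)
... | yes (x , x∈p─q) = inj₂ (≤-trans (s≤s z≤n) (x∈p⇒∣p-x∣<∣p∣ x∈p─q))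
... | no empty        = inj₁ p⊆q
  where
  p⊆q : p ⊆ q
  p⊆q {x} x∈p with x ∈? q
  ... | yes x∈q = x∈q
  ... | no x∉q  = contradiction (x , x∈p∧x∉q⇒x∈p─q x∈p x∉q) empty

f≤foldr-⊔ : ∀ {A : Set} (f : A → ℕ) {x xs} → x ∈ₗ xs → f x ≤ foldr _⊔_ 0 (map f xs)
f≤foldr-⊔ f {xs = y ∷ _} (here refl) = m≤m⊔n (f y) _
f≤foldr-⊔ f {xs = y ∷ _} (there x∈) = ≤-trans (f≤foldr-⊔ f x∈) (m≤n⊔m (f y) _)

m*n+m≤m*[n+o] : ∀ m {n o} → 1 ≤ o → m * n + m ≤ m * (n + o)
m*n+m≤m*[n+o] m {n} {o} 1≤o = begin
  m * n + m    ≡⟨ +-comm (m * n) m ⟩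
  m + m * n    ≡⟨ *-suc m n ⟨
  m * suc n    ≤⟨ *-monoʳ-≤ m (subst (_≤ n + o) (+-comm n 1) (+-monoʳ-≤ n 1≤o)) ⟩
  m * (n + o)  ∎
  where open ≤-Reasoning

m+o≤n+p⇒n≤q+o⇒m≤q+p : ∀ {m n o p q} → m + o ≤ n + p → n ≤ q + o → m ≤ q + p
m+o≤n+p⇒n≤q+o⇒m≤q+p {m} {n} {o} {p} {q} m+o≤n+p n≤q+o = +-cancelʳ-≤ o m (q + p) (begin
  m + o        ≤⟨ m+o≤n+p ⟩
  n + p        ≤⟨ +-monoˡ-≤ p n≤q+o ⟩
  q + o + p    ≡⟨ +-assoc q o p ⟩
  q + (o + p)  ≡⟨ cong (q +_) (+-comm o p) ⟩
  q + (p + o)  ≡⟨ +-assoc q p o ⟨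
  q + p + o    ∎)
  where open ≤-Reasoning

Recent : ∀ {n} → (Fin n → ℕ) → ℕ → Subset n → Set
Recent st t₀ P = ∀ z → z ∈ P ⇔ t₀ ≤ st z

module _ {n : ℕ} (k : ℕ) where

  -- c is DET's cost, o OPT's cost, C OPT's cache and P the current phase. Either OPT has paid
  -- for the phase already, or k is charged in advance and OPT's cache still fits together with P.
  Account : ℕ → Subset n → Subset n → ℕ → Set
  Account c C P o = c ≤ k * o + ∣ P ∣ ⊎ (c ≤ k * o + k + ∣ P ∣ × ∣ P ∪ C ∣ ≤ k)

  account-continue : ∀ {c c′ o} {C C′ P Q : Subset n} → Q ⊆ C′ → Account c C P o →
                     c′ + ∣ P ∣ ≤ c + ∣ P ∪ Q ∣ → Account c′ C′ (P ∪ Q) (o + ∣ C′ ─ C ∣)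
  account-continue {o = o} Q⊆C′ (inj₁ paid) served =
    inj₁ (≤-trans (m+o≤n+p⇒n≤q+o⇒m≤q+p served paid) (+-monoˡ-≤ _ (*-monoʳ-≤ k (m≤m+n o _))))
  account-continue {o = o} {C} {C′} {P} Q⊆C′ (inj₂ (charged , P∪C≤k)) served with ⊆⊎∣─∣≥1 C′ C
  ... | inj₂ 1≤d  = inj₁ (≤-trans (m+o≤n+p⇒n≤q+o⇒m≤q+p served charged) (+-monoˡ-≤ _ (m*n+m≤m*[n+o] k 1≤d)))
  ... | inj₁ C′⊆C = inj₂
    ( ≤-trans (m+o≤n+p⇒n≤q+o⇒m≤q+p served charged) (+-monoˡ-≤ _ (+-monoˡ-≤ k (*-monoʳ-≤ k (m≤m+n o _))))
    , ≤-trans (p⊆q⇒∣p∣≤∣q∣ (∪-least (∪-monoʳ-⊆ (C′⊆C ∘ Q⊆C′)) (q⊆p∪q P C ∘ C′⊆C))) P∪C≤k )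

  account-new-phase : ∀ {c c′ o} {C C′ P Q : Subset n} → Q ⊆ C′ → ∣ C′ ∣ ≤ k → ∣ P ∣ ≤ k →
                      k < ∣ P ∪ Q ∣ → Account c C P o → c′ ≤ c + ∣ Q ∣ → Account c′ C′ Q (o + ∣ C′ ─ C ∣)
  account-new-phase {c} {o = o} {C} {C′} {P} {Q} Q⊆C′ ∣C′∣≤k ∣P∣≤k overflow acc served =
    inj₂ (≤-trans served (+-monoˡ-≤ ∣ Q ∣ (paid acc)) , ≤-trans (p⊆q⇒∣p∣≤∣q∣ (∪-least Q⊆C′ ⊆-refl)) ∣C′∣≤k)
    where
    paid : Account c C P o → c ≤ k * (o + ∣ C′ ─ C ∣) + k
    paid (inj₁ h) = ≤-trans h (+-mono-≤ (*-monoʳ-≤ k (m≤m+n o _)) ∣P∣≤k)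
    paid (inj₂ (h , P∪C≤k)) with ⊆⊎∣─∣≥1 C′ C
    ... | inj₂ 1≤d  = ≤-trans h (+-mono-≤ (m*n+m≤m*[n+o] k 1≤d) ∣P∣≤k)
    ... | inj₁ C′⊆C =
      contradiction (≤-trans (p⊆q⇒∣p∣≤∣q∣ (∪-monoʳ-⊆ {p = P} (C′⊆C ∘ Q⊆C′))) P∪C≤k) (<⇒≱ overflow)

  account-bound : ∀ {c o C} {P : Subset n} → Account c C P o → ∣ P ∣ ≤ k → c ≤ k * o + (k + k)
  account-bound {o = o} (inj₁ h) ∣P∣≤k = ≤-trans h (+-monoʳ-≤ (k * o) (≤-trans ∣P∣≤k (m≤n+m k k)))
  account-bound {o = o} (inj₂ (h , _)) ∣P∣≤k =
    ≤-trans h (≤-trans (+-monoʳ-≤ (k * o + k) ∣P∣≤k) (≤-reflexive (+-assoc (k * o) k k)))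

module _ {n : ℕ} (k : ℕ) (E : Rel (Fin n) 0ℓ) (R? : ∀ x y → Dec (Star E x y)) where
  open Model k E R?

  ∈-items : ∀ x → x ∈ₗ items n
  ∈-items x = ∈-toList⁺ (∈-allFin⁺ x)

  ∈-cachedItems⁺ : ∀ {C z} → z ∈ C → z ∈ₗ cachedItems C
  ∈-cachedItems⁺ {z = z} z∈C = ∈-filter⁺ (_∈? _) (∈-items z) z∈C

  lruOf-nonempty : ∀ st {xs z} → z ∈ₗ xs → lruOf st xs ≢ nothing
  lruOf-nonempty st {x ∷ xs} _ with lruOf st xs
  ... | nothing = λ ()
  ... | just y with st y <ᵇ st x
  ...   | true  = λ ()
  ...   | false = λ ()

  lruOf-least : ∀ st xs {y z} → lruOf st xs ≡ just y → z ∈ₗ xs → st y ≤ st z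
  lruOf-least st (x ∷ xs) eq z∈ with lruOf st xs in lru
  lruOf-least st (x ∷ xs) refl (here refl) | nothing = ≤-refl
  lruOf-least st (x ∷ xs) refl (there z∈) | nothing = ⊥-elim (lruOf-nonempty st z∈ lru)
  ... | just y with st y <ᵇ st x in y<x
  lruOf-least st (x ∷ xs) refl (here refl) | just y | true  = <⇒≤ (<ᵇ⇒< _ _ (subst T (sym y<x) _))
  lruOf-least st (x ∷ xs) refl (there z∈) | just y | true  = lruOf-least st xs lru z∈
  lruOf-least st (x ∷ xs) refl (here refl) | just y | false = ≤-refl
  lruOf-least st (x ∷ xs) refl (there z∈) | just y | false =
    ≤-trans (≮⇒≥ (subst T y<x ∘ <⇒<ᵇ)) (lruOf-least st xs lru z∈)

  T-set : Fin n → Subset n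
  T-set w = V.tabulate (λ y → does (R? w y))

  ∈-T-set⁺ : ∀ {w y} → Star E w y → y ∈ T-set w
  ∈-T-set⁺ {w} {y} w→y = lookup⇒[]= y (T-set w) (trans (lookup∘tabulate _ y) (dec-true (R? w y) w→y))

  ∈-T-set⁻ : ∀ {w y} → y ∈ T-set w → Star E w y
  ∈-T-set⁻ {w} {y} y∈T =
    invert (subst (Reflects (Star E w y)) (trans (sym (lookup∘tabulate _ y)) ([]=⇒lookup y∈T)) (proof (R? w y)))

  Feasible⇒T-set⊆ : ∀ {C w} → Feasible C → w ∈ C → T-set w ⊆ C
  Feasible⇒T-set⊆ {w = w} feasible w∈C {z} z∈T = feasible w z w∈C (∈-T-set⁻ z∈T)

  module _ (π : Fin n ↔ Fin n) where
    open DET π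

    ∈-T-up⁺ : ∀ {w y} → Star E w y → y ∈ₗ T-up w
    ∈-T-up⁺ {y = y} w→y = ∈-filter⁺ (R? _) y∈τ w→y
      where
      y∈τ : y ∈ₗ τ-increasing
      y∈τ = subst (_∈ₗ τ-increasing) (Inverse.strictlyInverseʳ π y) (∈-map⁺ (Inverse.from π) (∈-items _))

    ∈-T-up⁻ : ∀ {w y} → y ∈ₗ T-up w → Star E w y
    ∈-T-up⁻ y∈ = proj₂ (∈-filter⁻ (R? _) {xs = τ-increasing} y∈)

    T-set⇔reverse-T-up : ∀ w z → z ∈ T-set w ⇔ z ∈ₗ reverse (T-up w)
    T-set⇔reverse-T-up w z = mk⇔ (reverse⁺ ∘ ∈-T-up⁺ ∘ ∈-T-set⁻) (∈-T-set⁺ ∘ ∈-T-up⁻ ∘ reverse⁻)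

    ClockAhead : DState → Set
    ClockAhead s = ∀ z → stamp s z < clock s

    stampNow : Fin n → DState → DState
    stampNow x (dstate C st t c) = dstate C (setStamp st x t) (suc t) c

    restamp-cache : ∀ L s → cache (restamp L s) ≡ cache s
    restamp-cache []       s = refl
    restamp-cache (x ∷ xs) s = restamp-cache xs (stampNow x s)

    restamp-cost : ∀ L s → cost (restamp L s) ≡ cost s
    restamp-cost []       s = refl
    restamp-cost (x ∷ xs) s = restamp-cost xs (stampNow x s)

    restamp-clock : ∀ L s → clock (restamp L s) ≡ length L + clock s
    restamp-clock []       s = refl
    restamp-clock (x ∷ xs) s = trans (restamp-clock xs (stampNow x s)) (+-suc (length xs) (clock s))

    restamp-untouched : ∀ L s z → stamp (restamp L s) z ≡ stamp s z ⊎ z ∈ₗ L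
    restamp-untouched []       s z = inj₁ refl
    restamp-untouched (x ∷ xs) s z with restamp-untouched xs (stampNow x s) z
    ... | inj₂ z∈xs = inj₂ (there z∈xs)
    ... | inj₁ eq with z ≟ x
    ...   | yes z≡x = inj₂ (here z≡x)
    ...   | no _    = inj₁ eq

    restamp-fresh : ∀ L s {z} → z ∈ₗ L → clock s ≤ stamp (restamp L s) z
    restamp-fresh (x ∷ xs) s (there z∈xs) = ≤-trans (n≤1+n _) (restamp-fresh xs (stampNow x s) z∈xs)
    restamp-fresh (x ∷ xs) s (here refl) with restamp-untouched xs (stampNow x s) x
    ... | inj₂ x∈xs = ≤-trans (n≤1+n _) (restamp-fresh xs (stampNow x s) x∈xs)
    ... | inj₁ eq with x ≟ x
    ...   | yes _  = ≤-reflexive (sym eq)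
    ...   | no x≢x = contradiction refl x≢x

    restamp-ahead : ∀ L s → ClockAhead s → ClockAhead (restamp L s)
    restamp-ahead []       s ahead = ahead
    restamp-ahead (x ∷ xs) s ahead = restamp-ahead xs (stampNow x s) ahead′
      where
      ahead′ : ClockAhead (stampNow x s)
      ahead′ z with z ≟ x
      ... | yes _ = n<1+n (clock s)
      ... | no _  = m<n⇒m<1+n (ahead z)

    restamp-extends-phase : ∀ L s {Q P t₀} → (∀ z → z ∈ Q ⇔ z ∈ₗ L) → Recent (stamp s) t₀ P → t₀ ≤ clock s →
                            Recent (stamp (restamp L s)) t₀ (P ∪ Q)
    restamp-extends-phase L s {Q} {P} {t₀} Q⇔L recent t₀≤t z = mk⇔ recent⇒≥ ≥⇒recent
      where
      recent⇒≥ : z ∈ P ∪ Q → t₀ ≤ stamp (restamp L s) z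
      recent⇒≥ z∈ with x∈p∪q⁻ P Q z∈ | restamp-untouched L s z
      ... | inj₂ z∈Q | _        = ≤-trans t₀≤t (restamp-fresh L s (to (Q⇔L z) z∈Q))
      ... | inj₁ _   | inj₂ z∈L = ≤-trans t₀≤t (restamp-fresh L s z∈L)
      ... | inj₁ z∈P | inj₁ eq  = subst (t₀ ≤_) (sym eq) (to (recent z) z∈P)
      ≥⇒recent : t₀ ≤ stamp (restamp L s) z → z ∈ P ∪ Q
      ≥⇒recent t₀≤ with restamp-untouched L s z
      ... | inj₁ eq  = x∈p∪q⁺ (inj₁ (from (recent z) (subst (t₀ ≤_) eq t₀≤)))
      ... | inj₂ z∈L = x∈p∪q⁺ (inj₂ (from (Q⇔L z) z∈L))

    restamp-starts-phase : ∀ L s {Q} → (∀ z → z ∈ Q ⇔ z ∈ₗ L) → ClockAhead s →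
                           Recent (stamp (restamp L s)) (clock s) Q
    restamp-starts-phase L s {Q} Q⇔L ahead z = mk⇔ (restamp-fresh L s ∘ to (Q⇔L z)) ≥⇒recent
      where
      ≥⇒recent : clock s ≤ stamp (restamp L s) z → z ∈ Q
      ≥⇒recent t≤ with restamp-untouched L s z
      ... | inj₁ eq  = contradiction (subst (clock s ≤_) eq t≤) (<⇒≱ (ahead z))
      ... | inj₂ z∈L = from (Q⇔L z) z∈L

    evictIfFull-shape : ∀ s → ∃ λ C → evictIfFull s ≡ dstate C (stamp s) (clock s) (cost s)
    evictIfFull-shape s with k ≤? ∣ cache s ∣
    ... | no _ = _ , refl
    ... | yes _ with lruOf (stamp s) (cachedItems (cache s))
    ...   | nothing = _ , refl
    ...   | just _  = _ , refl

    -- Were the least recent cached item a phase item, the whole cache would lie in the phase P,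
    -- and the cache, missing x ∈ P, would have fewer than ∣ P ∣ ≤ k items.
    evictIfFull-keeps-phase : ∀ s {t₀ P x} → Recent (stamp s) t₀ P → ∣ P ∣ ≤ k → x ∈ P → x ∉ cache s →
                              P ∩ cache s ⊆ cache (evictIfFull s)
    evictIfFull-keeps-phase s {P = P} {x} recent ∣P∣≤k x∈P x∉C {z} z∈P∩C
      with x∈p∩q⁻ P (cache s) z∈P∩C | k ≤? ∣ cache s ∣
    ... | _ , z∈C   | no _ = z∈C
    ... | z∈P , z∈C | yes full with lruOf (stamp s) (cachedItems (cache s)) in lru
    ...   | nothing = z∈C
    ...   | just y with z ≟ y
    ...     | no z≢y   = []≔-minimal (cache s) z y z≢y z∈C
    ...     | yes refl = contradiction full (<⇒≱ (<-≤-trans (p⊂q⇒∣p∣<∣q∣ (C⊆P , x , x∈P , x∉C)) ∣P∣≤k))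
      where
      C⊆P : cache s ⊆ P
      C⊆P {u} u∈C = from (recent u) (≤-trans (to (recent z) z∈P) (lruOf-least (stamp s) _ lru (∈-cachedItems⁺ u∈C)))

    fetchAll-keeps-stamps : ∀ L s → stamp (fetchAll L s) ≡ stamp s × clock (fetchAll L s) ≡ clock s
    fetchAll-keeps-stamps []       s = refl , refl
    fetchAll-keeps-stamps (x ∷ xs) s with x ∈? cache s
    ... | yes _ = fetchAll-keeps-stamps xs s
    ... | no _ with evictIfFull s | evictIfFull-shape s
    ...   | _ | C , refl = fetchAll-keeps-stamps xs (dstate (C V.[ x ]≔ inside) (stamp s) (clock s) (suc (cost s)))

    fetchAll-completes-phase :
      ∀ L s {t₀ P} → Recent (stamp s) t₀ P → ∣ P ∣ ≤ k → (∀ {z} → z ∈ₗ L → z ∈ P) →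
      (∀ {z} → z ∈ P → z ∈ cache s ⊎ z ∈ₗ L) →
      P ⊆ cache (fetchAll L s) × cost (fetchAll L s) + ∣ P ∩ cache s ∣ ≤ cost s + ∣ P ∩ cache (fetchAll L s) ∣
    fetchAll-completes-phase [] s recent ∣P∣≤k L⊆P P⊆C∪L = [ id , (λ ()) ]′ ∘ P⊆C∪L , ≤-refl
    fetchAll-completes-phase (x ∷ xs) s {P = P} recent ∣P∣≤k L⊆P P⊆C∪L with x ∈? cache s
    ... | yes x∈C = fetchAll-completes-phase xs s recent ∣P∣≤k (L⊆P ∘ there) P⊆C∪xs
      where
      P⊆C∪xs : ∀ {z} → z ∈ P → z ∈ cache s ⊎ z ∈ₗ xs
      P⊆C∪xs z∈P with P⊆C∪L z∈P
      ... | inj₁ z∈C          = inj₁ z∈C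
      ... | inj₂ (here refl)  = inj₁ x∈C
      ... | inj₂ (there z∈xs) = inj₂ z∈xs
    ... | no x∉C with evictIfFull s | evictIfFull-shape s | evictIfFull-keeps-phase s recent ∣P∣≤k (L⊆P (here refl)) x∉C
    ...   | _ | C₁ , refl | kept = proj₁ rest , ≤-pred (begin
        suc (cost′ + ∣ P ∩ cache s ∣)                   ≡⟨ +-suc cost′ _ ⟨
        cost′ + suc ∣ P ∩ cache s ∣                     ≤⟨ +-monoʳ-≤ cost′ grows ⟩
        cost′ + ∣ P ∩ C₂ ∣                              ≤⟨ proj₂ rest ⟩
        suc (cost s) + ∣ P ∩ cache (fetchAll xs s₂) ∣  ∎)
      where
      open ≤-Reasoning
      C₂ = C₁ V.[ x ]≔ inside
      s₂ = dstate C₂ (stamp s) (clock s) (suc (cost s))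
      cost′ = cost (fetchAll xs s₂)
      P⊆C₂∪xs : ∀ {z} → z ∈ P → z ∈ C₂ ⊎ z ∈ₗ xs
      P⊆C₂∪xs z∈P with P⊆C∪L z∈P
      ... | inj₁ z∈C          = inj₁ (∈-insert C₁ x (kept (x∈p∩q⁺ (z∈P , z∈C))))
      ... | inj₂ (here refl)  = inj₁ ([]≔-updates C₁ x)
      ... | inj₂ (there z∈xs) = inj₂ z∈xs
      rest = fetchAll-completes-phase xs s₂ recent ∣P∣≤k (L⊆P ∘ there) P⊆C₂∪xs
      grows : ∣ P ∩ cache s ∣ < ∣ P ∩ C₂ ∣
      grows = p⊂q⇒∣p∣<∣q∣
        ( (λ z∈ → x∈p∩q⁺ (proj₁ (x∈p∩q⁻ P (cache s) z∈) , ∈-insert C₁ x (kept z∈)))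
        , x , x∈p∩q⁺ (L⊆P (here refl) , []≔-updates C₁ x) , x∉C ∘ proj₂ ∘ x∈p∩q⁻ P (cache s) )

    serve-ahead : ∀ w s → ClockAhead s → ClockAhead (serve w s)
    serve-ahead w s ahead = subst₂ (λ st t → ∀ z → st z < t) (sym stamps) (sym clocks) (restamp-ahead L s ahead)
      where
      L = reverse (T-up w)
      stamps = proj₁ (fetchAll-keeps-stamps (T-up w) (restamp L s))
      clocks = proj₂ (fetchAll-keeps-stamps (T-up w) (restamp L s))

    clock≤clock-serve : ∀ w s → clock s ≤ clock (serve w s)
    clock≤clock-serve w s = begin
      clock s              ≤⟨ m≤n+m (clock s) (length L) ⟩
      length L + clock s   ≡⟨ restamp-clock L s ⟨
      clock (restamp L s)  ≡⟨ proj₂ (fetchAll-keeps-stamps (T-up w) (restamp L s)) ⟨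
      clock (serve w s)    ∎
      where
      open ≤-Reasoning
      L = reverse (T-up w)

    serve-completes-phase :
      ∀ w s {t₀ P} → Recent (stamp (restamp (reverse (T-up w)) s)) t₀ P → ∣ P ∣ ≤ k →
      T-set w ⊆ P → P ⊆ cache s ∪ T-set w →
      Recent (stamp (serve w s)) t₀ P × P ⊆ cache (serve w s) × cost (serve w s) + ∣ P ∩ cache s ∣ ≤ cost s + ∣ P ∣
    serve-completes-phase w s {t₀} {P} recent ∣P∣≤k T⊆P P⊆C∪T =
      subst (λ st → Recent st t₀ P) (sym (proj₁ (fetchAll-keeps-stamps (T-up w) s₁))) recent ,
      proj₁ fetched ,
      (begin
        cost (serve w s) + ∣ P ∩ cache s ∣   ≡⟨ cong (λ C → cost (serve w s) + ∣ P ∩ C ∣) (restamp-cache L s) ⟨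
        cost (serve w s) + ∣ P ∩ cache s₁ ∣  ≤⟨ proj₂ fetched ⟩
        cost s₁ + ∣ P ∩ cache (serve w s) ∣  ≤⟨ +-mono-≤ (≤-reflexive (restamp-cost L s)) (∣p∩q∣≤∣p∣ P _) ⟩
        cost s + ∣ P ∣                       ∎)
      where
      open ≤-Reasoning
      L = reverse (T-up w)
      s₁ = restamp L s
      P⊆C₁∪T-up : ∀ {z} → z ∈ P → z ∈ cache s₁ ⊎ z ∈ₗ T-up w
      P⊆C₁∪T-up {z} z∈P with x∈p∪q⁻ (cache s) (T-set w) (P⊆C∪T z∈P)
      ... | inj₁ z∈C = inj₁ (subst (z ∈_) (sym (restamp-cache L s)) z∈C)
      ... | inj₂ z∈T = inj₂ (∈-T-up⁺ (∈-T-set⁻ z∈T))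
      fetched = fetchAll-completes-phase (T-up w) s₁ recent ∣P∣≤k (T⊆P ∘ ∈-T-set⁺ ∘ ∈-T-up⁻) P⊆C₁∪T-up

    record Invariant (s : DState) (C : Subset n) (o : ℕ) : Set where
      field
        phase       : Subset n
        start       : ℕ
        recent      : Recent (stamp s) start phase
        ahead       : ClockAhead s
        started     : start ≤ clock s
        phase⊆cache : phase ⊆ cache s
        ∣phase∣≤k   : ∣ phase ∣ ≤ k
        account     : Account k (cost s) C phase o

    serve-continues-phase : ∀ {s C C′ o w} (I : Invariant s C o) → T-set w ⊆ C′ →
                            ∣ Invariant.phase I ∪ T-set w ∣ ≤ k → Invariant (serve w s) C′ (o + ∣ C′ ─ C ∣)
    serve-continues-phase {s} {w = w} I T⊆C′ fits =
      let (recent′ , phase′⊆cache , served) =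
            serve-completes-phase w s (restamp-extends-phase _ s (T-set⇔reverse-T-up w) recent started) fits
              (q⊆p∪q phase _) (∪-least (p⊆p∪q _ ∘ phase⊆cache) (q⊆p∪q _ _))
      in record
        { phase = phase ∪ T-set w ; start = start ; recent = recent′ ; ahead = serve-ahead w s ahead
        ; started = ≤-trans started (clock≤clock-serve w s) ; phase⊆cache = phase′⊆cache ; ∣phase∣≤k = fits
        ; account = account-continue k {P = phase} T⊆C′ account
                      (≤-trans (+-monoʳ-≤ _ (p⊆q⇒∣p∣≤∣q∣ phase⊆phase′∩cache)) served) }
      where
      open Invariant I
      phase⊆phase′∩cache : phase ⊆ (phase ∪ T-set w) ∩ cache s
      phase⊆phase′∩cache z∈ = x∈p∩q⁺ (p⊆p∪q _ z∈ , phase⊆cache z∈)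

    serve-starts-phase : ∀ {s C C′ o w} (I : Invariant s C o) → T-set w ⊆ C′ → ∣ C′ ∣ ≤ k →
                         k < ∣ Invariant.phase I ∪ T-set w ∣ → Invariant (serve w s) C′ (o + ∣ C′ ─ C ∣)
    serve-starts-phase {s} {w = w} I T⊆C′ ∣C′∣≤k overflow =
      let (recent′ , T⊆cache , served) =
            serve-completes-phase w s (restamp-starts-phase _ s (T-set⇔reverse-T-up w) ahead) ∣T∣≤k ⊆-refl
              (q⊆p∪q _ _)
      in record
        { phase = T-set w ; start = clock s ; recent = recent′ ; ahead = serve-ahead w s ahead
        ; started = clock≤clock-serve w s ; phase⊆cache = T⊆cache ; ∣phase∣≤k = ∣T∣≤k
        ; account = account-new-phase k {P = phase} T⊆C′ ∣C′∣≤k ∣phase∣≤k overflow account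
                      (≤-trans (m≤m+n _ _) served) }
      where
      open Invariant I
      ∣T∣≤k : ∣ T-set w ∣ ≤ k
      ∣T∣≤k = ≤-trans (p⊆q⇒∣p∣≤∣q∣ T⊆C′) ∣C′∣≤k

    serve-preserves-invariant : ∀ {s C C′ o w} → Invariant s C o → ValidCache C′ → w ∈ C′ →
                                Invariant (serve w s) C′ (o + ∣ C′ ─ C ∣)
    serve-preserves-invariant {w = w} I (feasible , ∣C′∣≤k) w∈C′ with ∣ Invariant.phase I ∪ T-set w ∣ ≤? k
    ... | yes fits    = serve-continues-phase I (Feasible⇒T-set⊆ feasible w∈C′) fits
    ... | no overflow = serve-starts-phase I (Feasible⇒T-set⊆ feasible w∈C′) ∣C′∣≤k (≰⇒> overflow)

    run-bound : ∀ {C σ S s o} → Schedule C σ S → Invariant s C o →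
                cost (run σ s) ≤ k * (o + scheduleCost C S) + (k + k)
    run-bound {s = s} {o} done I =
      subst (λ o′ → cost s ≤ k * o′ + (k + k)) (sym (+-identityʳ o)) (account-bound k {P = phase} account ∣phase∣≤k)
      where open Invariant I
    run-bound {C} {v ∷ σ} {C′ ∷ S} {s} {o} (step valid v∈C′ schedule) I =
      subst (λ o′ → cost (run σ (serve v s)) ≤ k * o′ + (k + k)) (+-assoc o ∣ C′ ─ C ∣ (scheduleCost C′ S))
        (run-bound schedule (serve-preserves-invariant I valid v∈C′))

    initState-invariant : ∀ {C₀} st₀ → ValidCache C₀ → Invariant (initState C₀ st₀) C₀ 0
    initState-invariant {C₀} st₀ (_ , ∣C₀∣≤k) = record
      { phase = ⊥ ; start = clock (initState C₀ st₀)
      ; recent = λ z → mk⇔ (λ z∈⊥ → contradiction z∈⊥ ∉⊥) (λ t≤ → contradiction t≤ (<⇒≱ (ahead z)))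
      ; ahead = ahead ; started = ≤-refl ; phase⊆cache = ⊆-min C₀
      ; ∣phase∣≤k = ≤-trans (p⊆q⇒∣p∣≤∣q∣ (⊆-min C₀)) ∣C₀∣≤k
      ; account = inj₂ (z≤n , ≤-trans (p⊆q⇒∣p∣≤∣q∣ (∪-least (⊆-min C₀) ⊆-refl)) ∣C₀∣≤k) }
      where
      ahead : ClockAhead (initState C₀ st₀)
      ahead z = s≤s (f≤foldr-⊔ st₀ (∈-items z))

theorem4 : (n k : ℕ) → 1 ≤ k →
    (E : Rel (Fin n) 0ℓ) → (R? : ∀ x y → Dec (Star E x y)) →
    Acyclic E →
    (∀ x → length (Model.deps k E R? x) ≤ k ∸ 1) →
    (π : Fin n ↔ Fin n) →
    (∀ x y → Dep E x y → Inverse.to π y Data.Fin.< Inverse.to π x) →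
    (C₀ : Subset n) → Model.ValidCache k E R? C₀ →
    (st₀ : Fin n → ℕ) → Injective _≡_ _≡_ st₀ →
    ∃ λ (α : ℕ) → ∀ (σ : List (Fin n)) (S : List (Subset n)) →
      Model.Schedule k E R? C₀ σ S →
      Model.DET.detCost k E R? π C₀ st₀ σ
        ≤ k * Model.scheduleCost k E R? C₀ S + α
theorem4 n k _ E R? _ _ π _ C₀ valid st₀ _ =
  k + k , λ σ S schedule → run-bound k E R? π schedule (initState-invariant k E R? π st₀ valid)
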